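{- Let $G$ be a graph with a fixed ordering of $V(G)$, $\mathsf{w}:V(G)\to\mathbb{Q}$, $\mathsf{opt}\in\{\min,\max\}$, $(T,\delta)$ a rooted layout of $G$, and $x$ an internal node of $T$ with children $a$ and $b$. Let $R'\subseteq\overline{V_x}$, $d\in\mathbb{N}^+$ with $d\ge 2$, $R\in\mathrm{Rep}^d_{V_x}$, and let $(A,A')\in\mathrm{Rep}^d_{V_a}\times\mathrm{Rep}^d_{\overline{V_a}}$ and $(B,B')\in\mathrm{Rep}^d_{V_b}\times\mathrm{Rep}^d_{\overline{V_b}}$ be $d$-$(R,R')$-compatible. Let $\mathcal{A}\subseteq 2^{V_a}$ be such that $X\equiv^d_{V_a}A$ for all $X\in\mathcal{A}$, and $\mathcal{B}\subseteq 2^{V_b}$ such that $W\equiv^d_{V_b}B$ for all $W\in\mathcal{B}$. If $\mathcal{A}'\subseteq\mathcal{A}$ $(a,A')^{\mathsf{acy}}$-represents $\mathcal{A}$ and $\mathcal{B}'\subseteq\mathcal{B}$ $(b,B')^{\mathsf{acy}}$-represents $\mathcal{B}$, then $\mathcal{A}'\otimes\mathcal{B}'$ $(x,R')^{\mathsf{acy}}$-represents $\mathcal{A}\otimes\mathcal{B}$.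
   Context: A rooted layout of $G$ is a pair $(T,\delta)$ with $T$ a rooted binary tree and $\delta$ a bijection between $V(G)$ and the leaves of $T$; for a node $y$, $V_y$ is the set of vertices $v$ such that the root-to-$\delta(v)$ path contains $y$, and $\overline{V_y}=V(G)\setminus V_y$. For $S\subseteq V(G)$, $X\equiv^d_S Y$ (for $X,Y\subseteq S$) means $\min(d,|X\cap N(u)|)=\min(d,|Y\cap N(u)|)$ for all $u\in V(G)\setminus S$. $\mathsf{rep}^d_S(X)$ is the lexicographically smallest among minimum-size $R\subseteq S$ with $R\equiv^d_S X$, and $\mathrm{Rep}^d_S=\{\mathsf{rep}^d_S(X):X\subseteq S\}$. $(A,A')$ and $(B,B')$ are $d$-$(R,R')$-compatible if $A\cup B\equiv^d_{V_x}R$, $A'\equiv^d_{\overline{V_a}}B\cup R'$ and $B'\equiv^d_{\overline{V_b}}A\cup R'$. $\mathcal{A}\otimes\mathcal{B}:=\emptyset$ if $\mathcal{A}=\emptyset$ or $\mathcal{B}=\emptyset$, else $\{X\cup Y:X\in\mathcal{A},Y\in\mathcal{B}\}$. For $\mathcal{C}\subseteq 2^{V(G)}$, $Y\subseteq V(G)$: $\mathsf{best}^{\mathsf{acy}}(\mathcal{C},Y):=\mathsf{opt}\{\mathsf{w}(X):X\in\mathcal{C},\ G[X\cup Y]\text{ is a tree}\}$ ($\mathsf{w}(X)=\sum_{v\in X}\mathsf{w}(v)$, $\min\emptyset=+\infty$, $\max\emptyset=-\infty$). For a node $y$, $S'\subseteq\overline{V_y}$ and $\mathcal{C},\mathcal{D}\subseteq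 2^{V_y}$, $\mathcal{D}$ $(y,S')^{\mathsf{acy}}$-represents $\mathcal{C}$ if $\mathsf{best}^{\mathsf{acy}}(\mathcal{C},Y)=\mathsf{best}^{\mathsf{acy}}(\mathcal{D},Y)$ for every $Y\subseteq\overline{V_y}$ with $Y\equiv^2_{\overline{V_y}}S'$. -}

module Defs where

open import Data.Nat as ℕ using (ℕ; zero; suc; _⊔_; _⊓_)
open import Data.Bool using (Bool; true; false; if_then_else_)
open import Data.Fin using (Fin; zero; suc)
open import Data.Fin.Subset as Sub using (Subset; _∈_; _∉_; _⊆_; ∁; _∩_; _∪_; ∣_∣; ⁅_⁆)
open import Data.Empty using (⊥)
open import Data.Vec using (Vec; []; _∷_; tabulate)
open import Data.List as List using (List; []; _∷_; _++_; [_]; length; concatMap; map)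
open import Data.List.Relation.Unary.All using (All)
open import Data.List.Relation.Unary.Unique.Propositional using (Unique)
open import Data.List.Relation.Unary.Linked using (Linked)
import Data.List.Membership.Propositional as LMem
open import Data.Rational as ℚ using (ℚ; 0ℚ) renaming (_+_ to _+ℚ_; _≤_ to _≤ℚ_)
open import Data.Product using (Σ; ∃; ∃-syntax; _×_; _,_)
open import Data.Sum using (_⊎_)
open import Relation.Binary.PropositionalEquality using (_≡_)
open import Relation.Nullary using (¬_)
open import Function.Bundles using (_⇔_)

-- Graphs on the vertex set Fin n (the order of Fin n is the fixed
-- ordering of V(G)); simple undirected graphs.

record Graph (n : ℕ) : Set where
  field
    adj   : Fin n → Fin n → Bool
    sym   : ∀ u v → adj u v ≡ adj v u
    irrefl : ∀ v → adj v v ≡ false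
open Graph public

Adj : ∀ {n} → Graph n → Fin n → Fin n → Set
Adj G u v = adj G u v ≡ true

N : ∀ {n} → Graph n → Fin n → Subset n
N G u = tabulate (adj G u)

data Walk {n} (G : Graph n) (Z : Subset n) : Fin n → Fin n → Set where
  here : ∀ {v} → v ∈ Z → Walk G Z v v
  step : ∀ {u v w} → u ∈ Z → Adj G u v → Walk G Z v w → Walk G Z u w

IsCycle : ∀ {n} → Graph n → Subset n → List (Fin n) → Set
IsCycle G Z []       = ⊥
IsCycle G Z (v ∷ vs) =
  (2 ℕ.≤ length vs) × Unique (v ∷ vs) × All (_∈ Z) (v ∷ vs)
  × Linked (Adj G) (v ∷ vs ++ [ v ])

IsTree : ∀ {n} → Graph n → Subset n → Set
IsTree G Z =
  (∃[ v ] v ∈ Z)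
  × (∀ u v → u ∈ Z → v ∈ Z → Walk G Z u v)
  × (¬ (∃[ c ] IsCycle G Z c))

-- Rooted layouts: full rooted binary trees with leaves labelled by
-- vertices, the labelling being a bijection onto V(G).

data Layout (n : ℕ) : Set where
  leaf : Fin n → Layout n
  node : Layout n → Layout n → Layout n

leafLabels : ∀ {n} → Layout n → List (Fin n)
leafLabels (leaf v)   = [ v ]
leafLabels (node l r) = leafLabels l ++ leafLabels r

IsRootedLayout : ∀ {n} → Layout n → Set
IsRootedLayout {n} T =
  Unique (leafLabels T) × (∀ (v : Fin n) → v LMem.∈ leafLabels T)

-- nodes of T, represented by the subtree rooted at them
data NodeOf {n} : Layout n → Layout n → Set where
  root  : ∀ {T} → NodeOf T T
  left  : ∀ {l r y} → NodeOf l y → NodeOf (node l r) y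
  right : ∀ {l r y} → NodeOf r y → NodeOf (node l r) y

V : ∀ {n} → Layout n → Subset n
V (leaf v)   = ⁅ v ⁆
V (node l r) = V l ∪ V r

Equiv : ∀ {n} → Graph n → ℕ → Subset n → Subset n → Subset n → Set
Equiv G d S X Y =
  ∀ u → u ∉ S → d ⊓ ∣ X ∩ N G u ∣ ≡ d ⊓ ∣ Y ∩ N G u ∣

-- lexicographic order w.r.t. the vertex ordering: X <lex Y iff at the
-- first vertex where X and Y differ, the vertex belongs to X
data LexLt : ∀ {n} → Subset n → Subset n → Set where
  first : ∀ {n} {X Y : Subset n} → LexLt (true ∷ X) (false ∷ Y)
  cons  : ∀ {n} {b} {X Y : Subset n} → LexLt X Y → LexLt (b ∷ X) (b ∷ Y)

LexLe : ∀ {n} → Subset n → Subset n → Set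
LexLe X Y = X ≡ Y ⊎ LexLt X Y

IsRep : ∀ {n} → Graph n → ℕ → Subset n → Subset n → Subset n → Set
IsRep G d S X R =
  R ⊆ S × Equiv G d S R X
  × (∀ R' → R' ⊆ S → Equiv G d S R' X → ∣ R ∣ ℕ.≤ ∣ R' ∣)
  × (∀ R' → R' ⊆ S → Equiv G d S R' X → ∣ R' ∣ ≡ ∣ R ∣ → LexLe R R')

InRep : ∀ {n} → Graph n → ℕ → Subset n → Subset n → Set
InRep G d S R = ∃[ X ] (X ⊆ S × IsRep G d S X R)

Compatible : ∀ {n} → Graph n → ℕ → (x a b : Layout n) →
             (R R' A A' B B' : Subset n) → Set
Compatible G d x a b R R' A A' B B' =
  Equiv G d (V x) (A ∪ B) R
  × Equiv G d (∁ (V a)) A' (B ∪ R')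
  × Equiv G d (∁ (V b)) B' (A ∪ R')

Family : ℕ → Set
Family n = List (Subset n)

_∈F_ : ∀ {n} → Subset n → Family n → Set
X ∈F 𝒞 = X LMem.∈ 𝒞

_⊆F_ : ∀ {n} → Family n → Family n → Set
𝒞 ⊆F 𝒟 = ∀ X → X ∈F 𝒞 → X ∈F 𝒟

_⊗_ : ∀ {n} → Family n → Family n → Family n
𝒜 ⊗ ℬ = concatMap (λ X → map (X ∪_) ℬ) 𝒜

weight : ∀ {n} → (Fin n → ℚ) → Subset n → ℚ
weight w []          = 0ℚ
weight w (b ∷ X) = (if b then w zero else 0ℚ) +ℚ weight (λ i → w (suc i)) X

data Opt : Set where
  min max : Opt

data ℚ∞ : Set where
  -∞ +∞ : ℚ∞
  fin   : ℚ → ℚ∞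

Better : Opt → ℚ → ℚ → Set
Better min q q' = q ≤ℚ q'
Better max q q' = q' ≤ℚ q

emptyValue : Opt → ℚ∞
emptyValue min = +∞
emptyValue max = -∞

IsBest : ∀ {n} → Graph n → (Fin n → ℚ) → Opt → Family n → Subset n → ℚ∞ → Set
IsBest G w opt 𝒞 Y v =
  ((∀ X → X ∈F 𝒞 → ¬ IsTree G (X ∪ Y)) × v ≡ emptyValue opt)
  ⊎ (∃[ X ] (X ∈F 𝒞 × IsTree G (X ∪ Y) × v ≡ fin (weight w X)
             × (∀ X' → X' ∈F 𝒞 → IsTree G (X' ∪ Y) →
                  Better opt (weight w X) (weight w X'))))

SameBest : ∀ {n} → Graph n → (Fin n → ℚ) → Opt → Family n → Family n → Subset n → Set
SameBest G w opt 𝒞 𝒟 Y = ∀ v → IsBest G w opt 𝒞 Y v ⇔ IsBest G w opt 𝒟 Y v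

Represents : ∀ {n} → Graph n → (Fin n → ℚ) → Opt → (y : Layout n) →
             (S' : Subset n) → (𝒟 𝒞 : Family n) → Set
Represents G w opt y S' 𝒟 𝒞 =
  ∀ Y → Y ⊆ ∁ (V y) → Equiv G 2 (∁ (V y)) Y S' → SameBest G w opt 𝒞 𝒟 Y

module Submission where

-- Fix a context Y ⊆ V(G) ∖ V_x with Y ≡²_{V(G)∖V_x} R'.  We
-- replace the two factors of 𝒜 ⊗ ℬ one at a time:
--   best(𝒜 ⊗ ℬ, Y) = best(𝒜' ⊗ ℬ, Y) = best(𝒜' ⊗ ℬ', Y).
-- For the first equality, every Z ∈ 𝒜 ⊗ ℬ splits as X ∪ W with X ⊆ V_a and
-- W ⊆ V_b disjoint, so that G[Z ∪ Y] = G[X ∪ (W ∪ Y)] and w(Z) = w(X) + w(W).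
-- Thus, slice by slice, only the family 𝒜 is queried, in the context W ∪ Y,
-- and compatibility gives W ∪ Y ≡²_{V(G)∖V_a} A', where 𝒜' represents 𝒜.
-- The second equality is the same argument with the roles of a and b swapped.

open import Defs hiding (sym)
open import Data.Nat using (ℕ; _≤_)
open import Data.Fin using (Fin)
open import Data.Fin.Subset using (Subset; _⊆_; ∁)
open import Data.Rational using (ℚ)

open import Data.Nat using (suc; _+_; _⊓_)
import Data.Nat.Properties as ℕP
open import Data.Bool using (Bool; true; false; _∨_; if_then_else_)
open import Data.Fin using (zero)
import Data.Fin as Fin
open import Data.Fin.Subset using (_∈_; _∉_; _∩_; _∪_; ∣_∣)
open import Data.Fin.Subset.Properties
  using (p⊆p∪q; q⊆p∪q; x∈p∪q⁻; p∩q⊆p; x∈∁p⇒x∉p; x∉∁p⇒x∈p; x∉p⇒x∈∁p; x∈p⇒x∉∁p;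
         x∈⁅y⁆⇒x≡y; ∪-assoc; ∪-comm; ∩-distribʳ-∪)
open import Data.Vec using ([]; _∷_; here; there)
open import Data.Rational using (0ℚ; -_) renaming (_+_ to _+ℚ_; _≤_ to _≤ℚ_)
import Data.Rational.Properties as ℚP
open import Algebra.Bundles using (CommutativeMonoid)
open import Algebra.Properties.CommutativeSemigroup
  (CommutativeMonoid.commutativeSemigroup ℚP.+-0-commutativeMonoid) using (interchange)
open import Data.List using (List; []; _∷_; _++_; map)
import Data.List.Relation.Unary.All as All
import Data.List.Relation.Unary.All.Properties as AllP
open import Data.List.Relation.Unary.AllPairs using ([]; _∷_)
open import Data.List.Relation.Unary.Unique.Propositional using (Unique)
import Data.List.Relation.Unary.Any as Any
import Data.List.Membership.Propositional as List
open import Data.List.Membership.Propositional.Properties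
  using (∈-++⁻; ∈-++⁺ˡ; ∈-++⁺ʳ; ∈-map⁻; ∈-map⁺)
open import Data.Product using (∃-syntax; _×_; _,_)
open import Data.Sum using (_⊎_; inj₁; inj₂)
open import Data.Empty using (⊥; ⊥-elim)
open import Relation.Binary.PropositionalEquality
  using (_≡_; _≢_; refl; sym; trans; cong; cong₂; subst; subst₂; module ≡-Reasoning)
open import Relation.Nullary using (¬_; Dec; yes; no)
open import Relation.Nullary.Decidable using (¬¬-excluded-middle; decidable-stable)
open import Relation.Nullary.Negation using (¬¬-map)
open import Function.Bundles using (mk⇔; Equivalence)
import Function.Properties.Equivalence as ⇔

Better-refl : ∀ opt q → Better opt q q
Better-refl min q = ℚP.≤-refl
Better-refl max q = ℚP.≤-refl

Better-trans : ∀ opt {p q r} → Better opt p q → Better opt q r → Better opt p r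
Better-trans min p≤q q≤r = ℚP.≤-trans p≤q q≤r
Better-trans max q≤p r≤q = ℚP.≤-trans r≤q q≤p

Better-total : ∀ opt p q → Better opt p q ⊎ Better opt q p
Better-total min p q = ℚP.≤-total p q
Better-total max p q = ℚP.≤-total q p

Better? : ∀ opt p q → Dec (Better opt p q)
Better? min p q = p ℚP.≤? q
Better? max p q = q ℚP.≤? p

+-cancelʳ-≤ : ∀ r {p q} → p +ℚ r ≤ℚ q +ℚ r → p ≤ℚ q
+-cancelʳ-≤ r {p} {q} le = subst₂ _≤ℚ_ (undo p) (undo q) (ℚP.+-monoˡ-≤ (- r) le)
  where
  undo : ∀ s → (s +ℚ r) +ℚ (- r) ≡ s
  undo s = begin
    (s +ℚ r) +ℚ (- r) ≡⟨ ℚP.+-assoc s r (- r) ⟩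
    s +ℚ (r +ℚ (- r)) ≡⟨ cong (s +ℚ_) (ℚP.+-inverseʳ r) ⟩
    s +ℚ 0ℚ           ≡⟨ ℚP.+-identityʳ s ⟩
    s                 ∎
    where open ≡-Reasoning

Better-+ʳ : ∀ opt {p q} r → Better opt p q → Better opt (p +ℚ r) (q +ℚ r)
Better-+ʳ min r le = ℚP.+-monoˡ-≤ r le
Better-+ʳ max r le = ℚP.+-monoˡ-≤ r le

Better-cancelʳ : ∀ opt {p q} r → Better opt (p +ℚ r) (q +ℚ r) → Better opt p q
Better-cancelʳ min r le = +-cancelʳ-≤ r le
Better-cancelʳ max r le = +-cancelʳ-≤ r le

fin≢emptyValue : ∀ opt {q} → fin q ≢ emptyValue opt
fin≢emptyValue min ()
fin≢emptyValue max ()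

fin-injective : ∀ {p q} → fin p ≡ fin q → p ≡ q
fin-injective refl = refl

Disjoint : ∀ {n} → Subset n → Subset n → Set
Disjoint X Y = ∀ {i} → i ∈ X → i ∈ Y → ⊥

Disjoint-sym : ∀ {n} {X Y : Subset n} → Disjoint X Y → Disjoint Y X
Disjoint-sym X#Y i∈Y i∈X = X#Y i∈X i∈Y

Disjoint-⊆ : ∀ {n} {X X' Y Y' : Subset n} →
             X ⊆ X' → Y ⊆ Y' → Disjoint X' Y' → Disjoint X Y
Disjoint-⊆ X⊆X' Y⊆Y' X'#Y' i∈X i∈Y = X'#Y' (X⊆X' i∈X) (Y⊆Y' i∈Y)

Disjoint-∁ : ∀ {n} (S : Subset n) → Disjoint S (∁ S)
Disjoint-∁ S i∈S i∈∁S = x∈∁p⇒x∉p i∈∁S i∈S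

Disjoint-tail : ∀ {n} {x y} {X Y : Subset n} → Disjoint (x ∷ X) (y ∷ Y) → Disjoint X Y
Disjoint-tail X#Y i∈X i∈Y = X#Y (there i∈X) (there i∈Y)

∣∪∣ : ∀ {n} (X Y : Subset n) → Disjoint X Y → ∣ X ∪ Y ∣ ≡ ∣ X ∣ + ∣ Y ∣
∣∪∣ []          []          _   = refl
∣∪∣ (true ∷ X)  (true ∷ Y)  X#Y = ⊥-elim (X#Y here here)
∣∪∣ (true ∷ X)  (false ∷ Y) X#Y = cong suc (∣∪∣ X Y (Disjoint-tail X#Y))
∣∪∣ (false ∷ X) (true ∷ Y)  X#Y =
  trans (cong suc (∣∪∣ X Y (Disjoint-tail X#Y))) (sym (ℕP.+-suc ∣ X ∣ ∣ Y ∣))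
∣∪∣ (false ∷ X) (false ∷ Y) X#Y = ∣∪∣ X Y (Disjoint-tail X#Y)

∣∪∩∣ : ∀ {n} (X Y Z : Subset n) → Disjoint X Y → ∣ (X ∪ Y) ∩ Z ∣ ≡ ∣ X ∩ Z ∣ + ∣ Y ∩ Z ∣
∣∪∩∣ X Y Z X#Y = trans (cong ∣_∣ (∩-distribʳ-∪ Z X Y))
  (∣∪∣ (X ∩ Z) (Y ∩ Z) (Disjoint-⊆ (p∩q⊆p X Z) (p∩q⊆p Y Z) X#Y))

weight-∪ : ∀ {n} (w : Fin n → ℚ) (X Y : Subset n) → Disjoint X Y →
           weight w (X ∪ Y) ≡ weight w X +ℚ weight w Y
weight-∪ w []      []      _   = sym (ℚP.+-identityʳ 0ℚ)
weight-∪ {suc n} w (x ∷ X) (y ∷ Y) X#Y = begin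
  h (x ∨ y) +ℚ weight w' (X ∪ Y)                  ≡⟨ cong₂ _+ℚ_ (h-∨ x y X#Y)
                                                       (weight-∪ w' X Y (Disjoint-tail X#Y)) ⟩
  (h x +ℚ h y) +ℚ (weight w' X +ℚ weight w' Y)    ≡⟨ interchange (h x) (h y) _ _ ⟩
  (h x +ℚ weight w' X) +ℚ (h y +ℚ weight w' Y)    ∎
  where
  open ≡-Reasoning
  w' : Fin n → ℚ
  w' i = w (Fin.suc i)
  h : Bool → ℚ
  h b = if b then w zero else 0ℚ
  h-∨ : ∀ x y → Disjoint (x ∷ X) (y ∷ Y) → h (x ∨ y) ≡ h x +ℚ h y
  h-∨ true  true  x#y = ⊥-elim (x#y here here)
  h-∨ true  false _   = sym (ℚP.+-identityʳ (w zero))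
  h-∨ false true  _   = sym (ℚP.+-identityˡ (w zero))
  h-∨ false false _   = sym (ℚP.+-identityˡ 0ℚ)

⊓-truncateˡ : ∀ k p q → k ⊓ (p + q) ≡ k ⊓ (k ⊓ p + q)
⊓-truncateˡ k p q with ℕP.≤-total k p
... | inj₁ k≤p = begin
  k ⊓ (p + q)     ≡⟨ ℕP.m≤n⇒m⊓n≡m (ℕP.≤-trans k≤p (ℕP.m≤m+n p q)) ⟩
  k               ≡⟨ sym (ℕP.m≤n⇒m⊓n≡m (ℕP.m≤m+n k q)) ⟩
  k ⊓ (k + q)     ≡⟨ cong (λ m → k ⊓ (m + q)) (sym (ℕP.m≤n⇒m⊓n≡m k≤p)) ⟩
  k ⊓ (k ⊓ p + q) ∎
  where open ≡-Reasoning
... | inj₂ p≤k = cong (λ m → k ⊓ (m + q)) (sym (ℕP.m≥n⇒m⊓n≡n p≤k))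

⊓-truncate-+ : ∀ k p q → k ⊓ (p + q) ≡ k ⊓ (k ⊓ p + k ⊓ q)
⊓-truncate-+ k p q = begin
  k ⊓ (p + q)             ≡⟨ ⊓-truncateˡ k p q ⟩
  k ⊓ (k ⊓ p + q)         ≡⟨ cong (k ⊓_) (ℕP.+-comm (k ⊓ p) q) ⟩
  k ⊓ (q + k ⊓ p)         ≡⟨ ⊓-truncateˡ k q (k ⊓ p) ⟩
  k ⊓ (k ⊓ q + k ⊓ p)     ≡⟨ cong (k ⊓_) (ℕP.+-comm (k ⊓ q) (k ⊓ p)) ⟩
  k ⊓ (k ⊓ p + k ⊓ q)     ∎
  where open ≡-Reasoning

⊓-truncate-⊓ : ∀ {k d} x → k ≤ d → k ⊓ (d ⊓ x) ≡ k ⊓ x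
⊓-truncate-⊓ {k} {d} x k≤d =
  trans (sym (ℕP.⊓-assoc k d x)) (cong (_⊓ x) (ℕP.m≤n⇒m⊓n≡m k≤d))

module _ {n} (G : Graph n) where

  Equiv-sym : ∀ {k S X Y} → Equiv G k S X Y → Equiv G k S Y X
  Equiv-sym X≡Y u u∉S = sym (X≡Y u u∉S)

  Equiv-trans : ∀ {k S X Y Z} → Equiv G k S X Y → Equiv G k S Y Z → Equiv G k S X Z
  Equiv-trans X≡Y Y≡Z u u∉S = trans (X≡Y u u∉S) (Y≡Z u u∉S)

  Equiv-weaken : ∀ {k d S X Y} → k ≤ d → Equiv G d S X Y → Equiv G k S X Y
  Equiv-weaken {k} {d} {S} {X} {Y} k≤d X≡Y u u∉S = begin
    k ⊓ ∣ X ∩ N G u ∣           ≡⟨ sym (⊓-truncate-⊓ _ k≤d) ⟩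
    k ⊓ (d ⊓ ∣ X ∩ N G u ∣)     ≡⟨ cong (k ⊓_) (X≡Y u u∉S) ⟩
    k ⊓ (d ⊓ ∣ Y ∩ N G u ∣)     ≡⟨ ⊓-truncate-⊓ _ k≤d ⟩
    k ⊓ ∣ Y ∩ N G u ∣           ∎
    where open ≡-Reasoning

  -- Only vertices outside S are tested, so S may be enlarged.
  Equiv-mono : ∀ {k S S' X Y} → (∀ {u} → u ∉ S' → u ∉ S) →
               Equiv G k S X Y → Equiv G k S' X Y
  Equiv-mono out X≡Y u u∉S' = X≡Y u (out u∉S')

  -- Disjoint unions of equivalent sets are equivalent (truncated counts add).
  Equiv-∪ : ∀ {k S X X' Y Y'} → Disjoint X Y → Disjoint X' Y' →
            Equiv G k S X X' → Equiv G k S Y Y' → Equiv G k S (X ∪ Y) (X' ∪ Y')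
  Equiv-∪ {k} {S} {X} {X'} {Y} {Y'} X#Y X'#Y' X≡X' Y≡Y' u u∉S = begin
    k ⊓ ∣ (X ∪ Y) ∩ Nu ∣                       ≡⟨ cong (k ⊓_) (∣∪∩∣ X Y Nu X#Y) ⟩
    k ⊓ (∣ X ∩ Nu ∣ + ∣ Y ∩ Nu ∣)              ≡⟨ ⊓-truncate-+ k _ _ ⟩
    k ⊓ (k ⊓ ∣ X ∩ Nu ∣ + k ⊓ ∣ Y ∩ Nu ∣)      ≡⟨ cong₂ (λ p q → k ⊓ (p + q))
                                                    (X≡X' u u∉S) (Y≡Y' u u∉S) ⟩
    k ⊓ (k ⊓ ∣ X' ∩ Nu ∣ + k ⊓ ∣ Y' ∩ Nu ∣)    ≡⟨ sym (⊓-truncate-+ k _ _) ⟩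
    k ⊓ (∣ X' ∩ Nu ∣ + ∣ Y' ∩ Nu ∣)            ≡⟨ cong (k ⊓_) (sym (∣∪∩∣ X' Y' Nu X'#Y')) ⟩
    k ⊓ ∣ (X' ∪ Y') ∩ Nu ∣                     ∎
    where
    open ≡-Reasoning
    Nu : Subset n
    Nu = N G u

  module _ {P Q S : Subset n} (P⊆S : P ⊆ S) (Q⊆S : Q ⊆ S) (P#Q : Disjoint P Q) where

    context-outside : ∀ {W Y} → W ⊆ Q → Y ⊆ ∁ S → W ∪ Y ⊆ ∁ P
    context-outside {W} {Y} W⊆Q Y⊆∁S i∈W∪Y with x∈p∪q⁻ W Y i∈W∪Y
    ... | inj₁ i∈W = x∉p⇒x∈∁p (λ i∈P → P#Q i∈P (W⊆Q i∈W))
    ... | inj₂ i∈Y = x∉p⇒x∈∁p (λ i∈P → Disjoint-∁ S (P⊆S i∈P) (Y⊆∁S i∈Y))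

    context-equiv : ∀ {d W B Y R' A'} → 2 ≤ d →
      W ⊆ Q → B ⊆ Q → Y ⊆ ∁ S → R' ⊆ ∁ S →
      Equiv G d Q W B → Equiv G 2 (∁ S) Y R' → Equiv G d (∁ P) A' (B ∪ R') →
      Equiv G 2 (∁ P) (W ∪ Y) A'
    context-equiv {d} {W} {B} {Y} {R'} {A'} 2≤d W⊆Q B⊆Q Y⊆∁S R'⊆∁S W≡B Y≡R' A'≡B∪R' =
      Equiv-trans {X = W ∪ Y} {Y = B ∪ R'} {Z = A'}
        W∪Y≡B∪R' (Equiv-sym {X = A'} {Y = B ∪ R'} A'≡²B∪R')
      where
      -- (Implicit sets are given by name: `Equiv` unfolds to a Π-type from
      -- which they cannot be inferred.)
      outside-Q : ∀ {u} → u ∉ ∁ P → u ∉ Q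
      outside-Q u∉∁P = P#Q (x∉∁p⇒x∈p u∉∁P)
      outside-∁S : ∀ {u} → u ∉ ∁ P → u ∉ ∁ S
      outside-∁S u∉∁P = x∈p⇒x∉∁p (P⊆S (x∉∁p⇒x∈p u∉∁P))
      separated : ∀ {X Z} → X ⊆ Q → Z ⊆ ∁ S → Disjoint X Z
      separated X⊆Q Z⊆∁S = Disjoint-⊆ (λ i∈X → Q⊆S (X⊆Q i∈X)) Z⊆∁S (Disjoint-∁ S)
      W≡²B : Equiv G 2 (∁ P) W B
      W≡²B = Equiv-mono {S = Q} {X = W} {Y = B} outside-Q
               (Equiv-weaken {X = W} {Y = B} 2≤d W≡B)
      Y≡²R' : Equiv G 2 (∁ P) Y R'
      Y≡²R' = Equiv-mono {S = ∁ S} {X = Y} {Y = R'} outside-∁S Y≡R'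
      W∪Y≡B∪R' : Equiv G 2 (∁ P) (W ∪ Y) (B ∪ R')
      W∪Y≡B∪R' = Equiv-∪ {X = W} {X' = B} {Y = Y} {Y' = R'}
                   (separated W⊆Q Y⊆∁S) (separated B⊆Q R'⊆∁S) W≡²B Y≡²R'
      A'≡²B∪R' : Equiv G 2 (∁ P) A' (B ∪ R')
      A'≡²B∪R' = Equiv-weaken {X = A'} {Y = B ∪ R'} 2≤d A'≡B∪R'

-- In a rooted layout the two children of a node have disjoint vertex sets,
-- because the leaf labelling is injective.

Unique-++⁻ˡ : ∀ {n} (xs : List (Fin n)) {ys} → Unique (xs ++ ys) → Unique xs
Unique-++⁻ˡ []       _            = []
Unique-++⁻ˡ (x ∷ xs) (x∉ ∷ uniq) = AllP.++⁻ˡ xs x∉ ∷ Unique-++⁻ˡ xs uniq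

Unique-++⁻ʳ : ∀ {n} (xs : List (Fin n)) {ys} → Unique (xs ++ ys) → Unique ys
Unique-++⁻ʳ []       uniq         = uniq
Unique-++⁻ʳ (x ∷ xs) (_ ∷ uniq)  = Unique-++⁻ʳ xs uniq

Unique-++-disjoint : ∀ {n} (xs : List (Fin n)) {ys} → Unique (xs ++ ys) →
                     ∀ {v} → v List.∈ xs → v List.∈ ys → ⊥
Unique-++-disjoint (x ∷ xs) (x∉ ∷ _) (Any.here refl) v∈ys =
  All.lookup (AllP.++⁻ʳ xs x∉) v∈ys refl
Unique-++-disjoint (x ∷ xs) (_ ∷ uniq) (Any.there v∈xs) v∈ys =
  Unique-++-disjoint xs uniq v∈xs v∈ys

Unique-subtree : ∀ {n} {T y : Layout n} → NodeOf T y →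
                 Unique (leafLabels T) → Unique (leafLabels y)
Unique-subtree root               uniq = uniq
Unique-subtree (left {l} y∈l)     uniq = Unique-subtree y∈l (Unique-++⁻ˡ (leafLabels l) uniq)
Unique-subtree (right {l} y∈r)    uniq = Unique-subtree y∈r (Unique-++⁻ʳ (leafLabels l) uniq)

V⊆leafLabels : ∀ {n} (t : Layout n) {i} → i ∈ V t → i List.∈ leafLabels t
V⊆leafLabels (leaf v)   i∈V = Any.here (x∈⁅y⁆⇒x≡y v i∈V)
V⊆leafLabels (node l r) i∈V with x∈p∪q⁻ (V l) (V r) i∈V
... | inj₁ i∈l = ∈-++⁺ˡ (V⊆leafLabels l i∈l)
... | inj₂ i∈r = ∈-++⁺ʳ (leafLabels l) (V⊆leafLabels r i∈r)

children-disjoint : ∀ {n} {T a b : Layout n} → IsRootedLayout T →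
                    NodeOf T (node a b) → Disjoint (V a) (V b)
children-disjoint {a = a} {b} (uniq , _) x∈T i∈a i∈b =
  Unique-++-disjoint (leafLabels a) (Unique-subtree x∈T uniq)
    (V⊆leafLabels a i∈a) (V⊆leafLabels b i∈b)

record IsProduct {n} (𝒞 𝒜 ℬ : Family n) : Set where
  field
    split : ∀ {Z} → Z ∈F 𝒞 → ∃[ X ] ∃[ W ] (X ∈F 𝒜 × W ∈F ℬ × Z ≡ X ∪ W)
    join  : ∀ {X W} → X ∈F 𝒜 → W ∈F ℬ → (X ∪ W) ∈F 𝒞
open IsProduct

⊗-isProduct : ∀ {n} (𝒜 ℬ : Family n) → IsProduct (𝒜 ⊗ ℬ) 𝒜 ℬ
⊗-isProduct 𝒜 ℬ = record { split = ⊗-split 𝒜 ; join = ⊗-join 𝒜 }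
  where
  ⊗-split : ∀ 𝒜 {Z} → Z ∈F (𝒜 ⊗ ℬ) → ∃[ X ] ∃[ W ] (X ∈F 𝒜 × W ∈F ℬ × Z ≡ X ∪ W)
  ⊗-split (X ∷ 𝒜) Z∈ with ∈-++⁻ (map (X ∪_) ℬ) Z∈
  ... | inj₁ Z∈X∪ℬ with ∈-map⁻ (X ∪_) Z∈X∪ℬ
  ...   | W , W∈ , Z≡ = X , W , Any.here refl , W∈ , Z≡
  ⊗-split (X ∷ 𝒜) Z∈ | inj₂ Z∈𝒜⊗ℬ with ⊗-split 𝒜 Z∈𝒜⊗ℬ
  ...   | X' , W , X'∈ , W∈ , Z≡ = X' , W , Any.there X'∈ , W∈ , Z≡
  ⊗-join : ∀ 𝒜 {X W} → X ∈F 𝒜 → W ∈F ℬ → (X ∪ W) ∈F (𝒜 ⊗ ℬ)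
  ⊗-join (X ∷ 𝒜) (Any.here refl) W∈ = ∈-++⁺ˡ (∈-map⁺ (X ∪_) W∈)
  ⊗-join (X ∷ 𝒜) (Any.there X'∈) W∈ = ∈-++⁺ʳ (map (X ∪_) ℬ) (⊗-join 𝒜 X'∈ W∈)

IsProduct-swap : ∀ {n} {𝒞 𝒜 ℬ : Family n} → IsProduct 𝒞 𝒜 ℬ → IsProduct 𝒞 ℬ 𝒜
IsProduct-swap {𝒞 = 𝒞} C = record
  { split = λ Z∈ → swap-split (split C Z∈)
  ; join  = λ {W} {X} W∈ X∈ → subst (_∈F 𝒞) (∪-comm X W) (join C X∈ W∈)
  }
  where
  swap-split : ∀ {𝒜 ℬ Z} → ∃[ X ] ∃[ W ] (X ∈F 𝒜 × W ∈F ℬ × Z ≡ X ∪ W) →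
                         ∃[ W ] ∃[ X ] (W ∈F ℬ × X ∈F 𝒜 × Z ≡ W ∪ X)
  swap-split (X , W , X∈ , W∈ , Z≡) = W , X , W∈ , X∈ , trans Z≡ (∪-comm X W)

IsProduct-⊆ : ∀ {n} {𝒞 𝒟 𝒜 𝒜' ℬ : Family n} →
              IsProduct 𝒞 𝒜 ℬ → IsProduct 𝒟 𝒜' ℬ → 𝒜' ⊆F 𝒜 → 𝒟 ⊆F 𝒞
IsProduct-⊆ C D 𝒜'⊆𝒜 Z Z∈ with split D Z∈
... | X , W , X∈ , W∈ , refl = join C (𝒜'⊆𝒜 X X∈) W∈

-- For 𝒟 ⊆ 𝒞, best(𝒞, Y) = best(𝒟, Y) holds exactly
-- when the optimum of 𝒞 is attained in 𝒟 and every feasible member of 𝒞 is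
-- dominated by a feasible member of 𝒟.  Feasibility (being a tree) is not
-- decided, so domination is only available under double negation; this
-- suffices because `Better` is decidable.

module Optima {n} (G : Graph n) (w : Fin n → ℚ) (opt : Opt) where

  wt : Subset n → ℚ
  wt = weight w

  Attained : Family n → Family n → Subset n → Set
  Attained 𝒞 𝒟 Y = ∀ q → IsBest G w opt 𝒞 Y (fin q) →
    ∃[ Z' ] (Z' ∈F 𝒟 × IsTree G (Z' ∪ Y) × wt Z' ≡ q)

  Dominated : Family n → Family n → Subset n → Set
  Dominated 𝒞 𝒟 Y = ∀ Z → Z ∈F 𝒞 → IsTree G (Z ∪ Y) →
    ¬ ¬ (∃[ Z' ] (Z' ∈F 𝒟 × IsTree G (Z' ∪ Y) × Better opt (wt Z') (wt Z)))

  best-cons : ∀ {𝒞 Y v} X → Dec (IsTree G (X ∪ Y)) → IsBest G w opt 𝒞 Y v →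
              ∃[ v' ] IsBest G w opt (X ∷ 𝒞) Y v'
  best-cons {v = v} X (no ¬t) (inj₁ (none , e)) =
    v , inj₁ ((λ { Z (Any.here refl) → ¬t ; Z (Any.there Z∈) → none Z Z∈ }) , e)
  best-cons {v = v} X (no ¬t) (inj₂ (X₁ , X₁∈ , t₁ , e , op)) =
    v , inj₂ (X₁ , Any.there X₁∈ , t₁ , e ,
      λ { Z (Any.here refl) t → ⊥-elim (¬t t) ; Z (Any.there Z∈) t → op Z Z∈ t })
  best-cons X (yes t) (inj₁ (none , _)) =
    fin (wt X) , inj₂ (X , Any.here refl , t , refl ,
      λ { Z (Any.here refl) _ → Better-refl opt (wt X) ; Z (Any.there Z∈) t' → ⊥-elim (none Z Z∈ t') })
  best-cons {v = v} X (yes t) (inj₂ (X₁ , X₁∈ , t₁ , e , op)) with Better-total opt (wt X) (wt X₁)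
  ... | inj₁ X≤X₁ = fin (wt X) , inj₂ (X , Any.here refl , t , refl ,
      λ { Z (Any.here refl) _ → Better-refl opt (wt X)
        ; Z (Any.there Z∈) t' → Better-trans opt X≤X₁ (op Z Z∈ t') })
  ... | inj₂ X₁≤X = v , inj₂ (X₁ , Any.there X₁∈ , t₁ , e ,
      λ { Z (Any.here refl) _ → X₁≤X ; Z (Any.there Z∈) t' → op Z Z∈ t' })

  best-exists : ∀ 𝒞 Y → ¬ ¬ (∃[ v ] IsBest G w opt 𝒞 Y v)
  best-exists []      Y k = k (emptyValue opt , inj₁ ((λ _ ()) , refl))
  best-exists (X ∷ 𝒞) Y k = best-exists 𝒞 Y λ { (v , best) →
    ¬¬-excluded-middle (λ feasible? → k (best-cons X feasible? best)) }

  SameBest⇒Attained : ∀ {𝒞 𝒟 Y} → SameBest G w opt 𝒞 𝒟 Y → Attained 𝒞 𝒟 Y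
  SameBest⇒Attained same q best with Equivalence.to (same (fin q)) best
  ... | inj₁ (_ , e) = ⊥-elim (fin≢emptyValue opt e)
  ... | inj₂ (Z' , Z'∈ , t' , e , _) = Z' , Z'∈ , t' , sym (fin-injective e)

  -- Equal optima force domination: compare with the (classically existing)
  -- optimum of 𝒞, which is also attained in 𝒟.
  SameBest⇒Dominated : ∀ {𝒞 𝒟 Y} → SameBest G w opt 𝒞 𝒟 Y → Dominated 𝒞 𝒟 Y
  SameBest⇒Dominated {𝒞} {Y = Y} same Z Z∈ t undominated =
    best-exists 𝒞 Y λ { (v , best) → refute v best }
    where
    refute : ∀ v → IsBest G w opt 𝒞 Y v → ⊥
    refute v (inj₁ (none , _)) = none Z Z∈ t
    refute v best@(inj₂ (Z₁ , _ , _ , e₁ , op₁)) with Equivalence.to (same v) best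
    ... | inj₁ (_ , e) = fin≢emptyValue opt (trans (sym e₁) e)
    ... | inj₂ (Z' , Z'∈ , t' , e' , _) = undominated (Z' , Z'∈ , t' ,
          subst (λ q → Better opt q (wt Z)) (fin-injective (trans (sym e₁) e')) (op₁ Z Z∈ t))

  Attained∧Dominated⇒SameBest : ∀ {𝒞 𝒟 Y} → 𝒟 ⊆F 𝒞 →
    Attained 𝒞 𝒟 Y → Dominated 𝒞 𝒟 Y → SameBest G w opt 𝒞 𝒟 Y
  Attained∧Dominated⇒SameBest {𝒞} {𝒟} {Y} 𝒟⊆𝒞 attained dominated v = mk⇔ restrict extend
    where
    restrict : IsBest G w opt 𝒞 Y v → IsBest G w opt 𝒟 Y v
    restrict (inj₁ (none , e)) = inj₁ ((λ Z Z∈ → none Z (𝒟⊆𝒞 Z Z∈)) , e)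
    restrict best@(inj₂ (Z , _ , _ , refl , op)) with attained (wt Z) best
    ... | Z' , Z'∈ , t' , wZ'≡wZ = inj₂ (Z' , Z'∈ , t' , cong fin (sym wZ'≡wZ) ,
          λ Z₀ Z₀∈ t₀ → subst (λ q → Better opt q (wt Z₀)) (sym wZ'≡wZ) (op Z₀ (𝒟⊆𝒞 Z₀ Z₀∈) t₀))
    extend : IsBest G w opt 𝒟 Y v → IsBest G w opt 𝒞 Y v
    extend (inj₁ (none , e)) =
      inj₁ ((λ Z Z∈ t → dominated Z Z∈ t λ { (Z' , Z'∈ , t' , _) → none Z' Z'∈ t' }) , e)
    extend (inj₂ (Z , Z∈ , t , e , op)) = inj₂ (Z , 𝒟⊆𝒞 Z Z∈ , t , e ,
      λ Z₀ Z₀∈ t₀ → decidable-stable (Better? opt _ _)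
        (¬¬-map (λ { (Z' , Z'∈ , t' , Z'≤Z₀) → Better-trans opt (op Z' Z'∈ t') Z'≤Z₀ })
                (dominated Z₀ Z₀∈ t₀)))

  -- The members of
  -- the factors are pairwise disjoint, so for Z = X ∪ W we have
  -- Z ∪ Y = X ∪ (W ∪ Y) and w(Z) = w(X) + w(W): the product queried in
  -- context Y is, slice by slice, the factor 𝒜 queried in context W ∪ Y.
  module ReplaceFactor {𝒜 𝒜' ℬ 𝒞 𝒟 : Family n}
    (C : IsProduct 𝒞 𝒜 ℬ) (D : IsProduct 𝒟 𝒜' ℬ) (𝒜'⊆𝒜 : 𝒜' ⊆F 𝒜)
    (separated : ∀ {X W} → X ∈F 𝒜 → W ∈F ℬ → Disjoint X W) (Y : Subset n) where

    wt-∪ : ∀ {X W} → X ∈F 𝒜 → W ∈F ℬ → wt (X ∪ W) ≡ wt X +ℚ wt W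
    wt-∪ {X} {W} X∈ W∈ = weight-∪ w X W (separated X∈ W∈)

    regroup : ∀ X W → IsTree G ((X ∪ W) ∪ Y) → IsTree G (X ∪ (W ∪ Y))
    regroup X W = subst (IsTree G) (∪-assoc X W Y)

    ungroup : ∀ X W → IsTree G (X ∪ (W ∪ Y)) → IsTree G ((X ∪ W) ∪ Y)
    ungroup X W = subst (IsTree G) (sym (∪-assoc X W Y))

    best-slice : ∀ {X W} → X ∈F 𝒜 → W ∈F ℬ → IsTree G ((X ∪ W) ∪ Y) →
      (∀ Z → Z ∈F 𝒞 → IsTree G (Z ∪ Y) → Better opt (wt (X ∪ W)) (wt Z)) →
      IsBest G w opt 𝒜 (W ∪ Y) (fin (wt X))
    best-slice {X} {W} X∈ W∈ t op = inj₂ (X , X∈ , regroup X W t , refl ,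
      λ X₀ X₀∈ t₀ → Better-cancelʳ opt (wt W)
        (subst₂ (Better opt) (wt-∪ X∈ W∈) (wt-∪ X₀∈ W∈)
          (op (X₀ ∪ W) (join C X₀∈ W∈) (ungroup X₀ W t₀))))

    -- An optimum X ∪ W of 𝒞 is attained in 𝒟 by X' ∪ W, where X' ∈ 𝒜' attains
    -- the optimum X of the slice of W.
    product-attained : (∀ {W} → W ∈F ℬ → Attained 𝒜 𝒜' (W ∪ Y)) → Attained 𝒞 𝒟 Y
    product-attained attained q (inj₁ (_ , e)) = ⊥-elim (fin≢emptyValue opt e)
    product-attained attained q (inj₂ (Z , Z∈ , t , e , op)) with split C Z∈
    ... | X , W , X∈ , W∈ , refl with attained W∈ (wt X) (best-slice X∈ W∈ t op)
    ...   | X' , X'∈ , t' , wX'≡wX = X' ∪ W , join D X'∈ W∈ , ungroup X' W t' , weights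
      where
      open ≡-Reasoning
      weights : wt (X' ∪ W) ≡ q
      weights = begin
        wt (X' ∪ W)      ≡⟨ wt-∪ (𝒜'⊆𝒜 X' X'∈) W∈ ⟩
        wt X' +ℚ wt W    ≡⟨ cong (_+ℚ wt W) wX'≡wX ⟩
        wt X +ℚ wt W     ≡⟨ sym (wt-∪ X∈ W∈) ⟩
        wt (X ∪ W)       ≡⟨ fin-injective (sym e) ⟩
        q                ∎

    -- X ∪ W ∈ 𝒞 is dominated by X' ∪ W ∈ 𝒟, where X' dominates X in the slice of W.
    product-dominated : (∀ {W} → W ∈F ℬ → Dominated 𝒜 𝒜' (W ∪ Y)) → Dominated 𝒞 𝒟 Y
    product-dominated dominated Z Z∈ t with split C Z∈
    ... | X , W , X∈ , W∈ , refl = ¬¬-map extend (dominated W∈ X X∈ (regroup X W t))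
      where
      extend : ∃[ X' ] (X' ∈F 𝒜' × IsTree G (X' ∪ (W ∪ Y)) × Better opt (wt X') (wt X)) →
               ∃[ Z' ] (Z' ∈F 𝒟 × IsTree G (Z' ∪ Y) × Better opt (wt Z') (wt (X ∪ W)))
      extend (X' , X'∈ , t' , X'≤X) = X' ∪ W , join D X'∈ W∈ , ungroup X' W t' ,
        subst₂ (Better opt) (sym (wt-∪ (𝒜'⊆𝒜 X' X'∈) W∈)) (sym (wt-∪ X∈ W∈))
          (Better-+ʳ opt (wt W) X'≤X)

    replace-factor : (∀ {W} → W ∈F ℬ → SameBest G w opt 𝒜 𝒜' (W ∪ Y)) →
                     SameBest G w opt 𝒞 𝒟 Y
    replace-factor same = Attained∧Dominated⇒SameBest (IsProduct-⊆ C D 𝒜'⊆𝒜)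
      (product-attained (λ W∈ → SameBest⇒Attained (same W∈)))
      (product-dominated (λ W∈ → SameBest⇒Dominated (same W∈)))

lemma6p3 : ∀ {n} (G : Graph n) (w : Fin n → ℚ) (opt : Opt)
    (T : Layout n) → IsRootedLayout T →
    (a b : Layout n) → NodeOf T (node a b) →
    (R' : Subset n) → R' ⊆ ∁ (V (node a b)) →
    (d : ℕ) → 2 ≤ d →
    (R : Subset n) → InRep G d (V (node a b)) R →
    (A A' B B' : Subset n) →
    InRep G d (V a) A → InRep G d (∁ (V a)) A' →
    InRep G d (V b) B → InRep G d (∁ (V b)) B' →
    Compatible G d (node a b) a b R R' A A' B B' →
    (𝒜 ℬ 𝒜' ℬ' : Family n) →
    (∀ X → X ∈F 𝒜 → X ⊆ V a) → (∀ X → X ∈F 𝒜 → Equiv G d (V a) X A) →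
    (∀ W → W ∈F ℬ → W ⊆ V b) → (∀ W → W ∈F ℬ → Equiv G d (V b) W B) →
    𝒜' ⊆F 𝒜 → Represents G w opt a A' 𝒜' 𝒜 →
    ℬ' ⊆F ℬ → Represents G w opt b B' ℬ' ℬ →
    Represents G w opt (node a b) R' (𝒜' ⊗ ℬ') (𝒜 ⊗ ℬ)
lemma6p3 G w opt _ layout a b x∈T R' R'⊆∁Vx _ 2≤d _ _ _ A' _ B'
         (_ , _ , A⊆Va , _) _ (_ , _ , B⊆Vb , _) _ (_ , A'≡B∪R' , B'≡A∪R')
         𝒜 ℬ 𝒜' ℬ' 𝒜⊆Va 𝒜≡A ℬ⊆Vb ℬ≡B 𝒜'⊆𝒜 𝒜'-represents ℬ'⊆ℬ ℬ'-represents Y Y⊆∁Vx Y≡R' v =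
  ⇔.trans (replace-𝒜 v) (replace-ℬ v)
  where
  open Optima G w opt
  Va#Vb : Disjoint (V a) (V b)
  Va#Vb = children-disjoint layout x∈T
  Va⊆Vx : V a ⊆ V (node a b)
  Va⊆Vx = p⊆p∪q (V b)
  Vb⊆Vx : V b ⊆ V (node a b)
  Vb⊆Vx = q⊆p∪q (V a) (V b)

  𝒜-slices : ∀ {W} → W ∈F ℬ → SameBest G w opt 𝒜 𝒜' (W ∪ Y)
  𝒜-slices {W} W∈ = 𝒜'-represents (W ∪ Y)
    (context-outside G Va⊆Vx Vb⊆Vx Va#Vb (ℬ⊆Vb W W∈) Y⊆∁Vx)
    (context-equiv G Va⊆Vx Vb⊆Vx Va#Vb {A' = A'} 2≤d (ℬ⊆Vb W W∈) B⊆Vb Y⊆∁Vx R'⊆∁Vx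
      (ℬ≡B W W∈) Y≡R' A'≡B∪R')

  ℬ-slices : ∀ {X} → X ∈F 𝒜' → SameBest G w opt ℬ ℬ' (X ∪ Y)
  ℬ-slices {X} X∈ = ℬ'-represents (X ∪ Y)
    (context-outside G Vb⊆Vx Va⊆Vx (Disjoint-sym Va#Vb) (𝒜⊆Va X (𝒜'⊆𝒜 X X∈)) Y⊆∁Vx)
    (context-equiv G Vb⊆Vx Va⊆Vx (Disjoint-sym Va#Vb) {A' = B'} 2≤d (𝒜⊆Va X (𝒜'⊆𝒜 X X∈)) A⊆Va
      Y⊆∁Vx R'⊆∁Vx (𝒜≡A X (𝒜'⊆𝒜 X X∈)) Y≡R' B'≡A∪R')

  replace-𝒜 : SameBest G w opt (𝒜 ⊗ ℬ) (𝒜' ⊗ ℬ) Y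
  replace-𝒜 = ReplaceFactor.replace-factor (⊗-isProduct 𝒜 ℬ) (⊗-isProduct 𝒜' ℬ) 𝒜'⊆𝒜
    (λ {X} {W} X∈ W∈ → Disjoint-⊆ (𝒜⊆Va X X∈) (ℬ⊆Vb W W∈) Va#Vb) Y 𝒜-slices

  replace-ℬ : SameBest G w opt (𝒜' ⊗ ℬ) (𝒜' ⊗ ℬ') Y
  replace-ℬ = ReplaceFactor.replace-factor
    (IsProduct-swap (⊗-isProduct 𝒜' ℬ)) (IsProduct-swap (⊗-isProduct 𝒜' ℬ')) ℬ'⊆ℬ
    (λ {W} {X} W∈ X∈ → Disjoint-⊆ (ℬ⊆Vb W W∈) (𝒜⊆Va X (𝒜'⊆𝒜 X X∈)) (Disjoint-sym Va#Vb))
    Y ℬ-slices
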